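{- Let $\Gamma$ be a class of sentences, $\mathbf x$ a context, $x\notin\mathbf x$ a variable, $\Delta$ a finite Boolean subalgebra of $\mathcal Q_{A,\mathbf x\cup\{x\}}[\mathcal N]$ and $\sigma_\Delta\colon\Gamma(C_\Delta)\to\Gamma\odot\Delta$ the associated $\Gamma$-substitution. Define $\tau_\Delta\colon A^*\otimes\mathbb N^{|\mathbf x|}\to C_\Delta^*$ by $\tau_\Delta(w,\mathbf i)=\xi_\Delta(w,\mathbf i,1)\cdots\xi_\Delta(w,\mathbf i,|w|)$. Then for every $\psi\in\Gamma(C_\Delta)$, $L_{\sigma_\Delta(\psi)}=\tau_\Delta^{ -1}(L_\psi)$; that is, $\tau_\Delta^{ -1}\colon\mathcal P(C_\Delta^*)\to\mathcal P(A^*\otimes\mathbb N^{|\mathbf x|})$ extends $\sigma_\Delta$ under the identification of formulas with their sets of models.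
   Context: Logic on words: fix a finite alphabet $A$, a set $\mathcal N$ of numerical predicates (each a subset $R\subseteq\mathbb N^k$ for some $k$) and a set $\mathcal Q$ of quantifiers (each a function $Q\colon\{0,1\}^*\to\{0,1\}$). Formulas are built from atomic formulas $\mathsf P_a(y)$ ($a$ a letter) and $R(y_1,\dots,y_k)$ ($R\in\mathcal N$), Boolean connectives, and $Qy\,\phi$ ($Q\in\mathcal Q$). A context is a finite set of variables; a formula is in context $\mathbf y$ if its free variables lie in $\mathbf y$. Its models are marked words $(w,\mathbf i)$ with $w\in A^*$ and $\mathbf i\colon\mathbf y\to\{1,\dots,|w|\}$; their set is $A^*\otimes\mathbb N^{|\mathbf y|}$ (equal to $A^*$ for the empty context). Semantics: $(w,\mathbf i)\models\mathsf P_a(y)$ iff the $\mathbf i(y)$-th letter of $w$ is $a$; $(w,\mathbf i)\models R(y_1,\dots,y_k)$ iff $(\mathbf i(y_1),\dots,\mathbf i(y_k))\in R$; connectives are classical; $(w,\mathbf i)\models Qy\,\phi$ iff $Q(\epsilon_1\cdots\epsilon_{|w|})=1$, $\epsilon_j$ the truth value of $(w,\mathbf i[y\mapsto j])\models\phi$. $L_\phi$ is the set of models of $\phi$. $\mathcal Q_{A,\mathbf y}[\mathcal N]$ is the Boolean algebra of formulas over $A$ in context $\mathbf y$ modulo semantic equivalence, $\mathcal Q_A[\mathcal N]$ that of sentences. For a map $\zeta\colon A\to B$, $\zeta_{\mathcal Q[\mathcal N]}\colon\mathcal Q_B[\mathcal N]\to\mathcal Q_A[\mathcal N]$ replaces each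 $\mathsf P_b(z)$ by $\bigvee_{\zeta(a)=b}\mathsf P_a(z)$. A class of sentences $\Gamma$ assigns to each finite alphabet $B$ a Boolean subalgebra $\Gamma(B)\subseteq\mathcal Q_B[\mathcal N]$ such that each $\zeta_{\mathcal Q[\mathcal N]}$ maps $\Gamma(B)$ into $\Gamma(A)$. Substitution: $C_\Delta$ is the set of atoms of $\Delta$, viewed as a finite alphabet; $\phi_c$ is the atom corresponding to $c\in C_\Delta$. The $\Gamma$-substitution $\sigma_\Delta\colon\Gamma(C_\Delta)\to\mathcal Q_{A,\mathbf x}[\mathcal N]$ sends a sentence $\psi$ (whose variables are chosen not to occur in the formulas of $\Delta$) to the formula obtained by replacing each occurrence of $\mathsf P_c(z)$ by $\phi_c[x/z]$ ($x$ replaced by $z$); it is a Boolean homomorphism and $\Gamma\odot\Delta$ denotes its image. $\xi_\Delta\colon A^*\otimes\mathbb N^{|\mathbf x\cup\{x\}|}\to C_\Delta$ sends a marked word to the unique $c$ with $(w,\mathbf i,j)\models\phi_c$, where $(w,\mathbf i,j)$ interprets $\mathbf x$ by $\mathbf i$ and $x$ by $j$. -}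

module Defs where

open import Data.Nat using (ℕ; zero; suc; _≤_; _≟_; _≡ᵇ_)
open import Data.Bool using (Bool; true; false; _∧_; _∨_; not; if_then_else_)
open import Data.Fin using (Fin)
import Data.Fin as F
open import Data.List using (List; []; _∷_; map; filter; foldr; length; upTo; allFin; _++_)
open import Data.List.Membership.Propositional using (_∈_; _∉_)
open import Data.List.Relation.Unary.All using (All)
open import Data.List.Relation.Unary.Any using (Any)
open import Data.Maybe using (Maybe; just; nothing)
open import Data.Vec using (Vec)
import Data.Vec as V
open import Data.Product using (Σ; _×_; ∃)
open import Data.Sum using (_⊎_)
open import Relation.Nullary using (¬_; ¬?; does)
open import Relation.Binary.PropositionalEquality using (_≡_)

record Signature : Set₁ where
  field
    NPred  : Set
    arity  : NPred → ℕ
    relN   : (r : NPred) → Vec ℕ (arity r) → Bool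
    Quant  : Set
    quant  : Quant → List Bool → Bool

open Signature public

Var : Set
Var = ℕ

Context : Set
Context = List Var

data Formula (S : Signature) (n : ℕ) : Set where
  Pₐ   : Fin n → Var → Formula S n
  Rel  : (r : NPred S) → Vec Var (arity S r) → Formula S n
  ftrue ffalse : Formula S n
  fnot : Formula S n → Formula S n
  fand for : Formula S n → Formula S n → Formula S n
  Qu   : Quant S → Var → Formula S n → Formula S n

module _ {S : Signature} {n : ℕ} where

  fv : Formula S n → List Var
  fv (Pₐ a y) = y ∷ []
  fv (Rel r ys) = V.toList ys
  fv ftrue = []
  fv ffalse = []
  fv (fnot φ) = fv φ
  fv (fand φ ψ) = fv φ ++ fv ψ
  fv (for φ ψ) = fv φ ++ fv ψ
  fv (Qu q y φ) = filter (λ v → ¬? (v ≟ y)) (fv φ)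

  vars : Formula S n → List Var
  vars (Pₐ a y) = y ∷ []
  vars (Rel r ys) = V.toList ys
  vars ftrue = []
  vars ffalse = []
  vars (fnot φ) = vars φ
  vars (fand φ ψ) = vars φ ++ vars ψ
  vars (for φ ψ) = vars φ ++ vars ψ
  vars (Qu q y φ) = y ∷ vars φ

  InContext : Context → Formula S n → Set
  InContext ctx φ = All (_∈ ctx) (fv φ)

-- Semantics.  Positions are 1-based: 1,…,|w|.

letterAt : {A : Set} → List A → ℕ → Maybe A
letterAt [] _ = nothing
letterAt (a ∷ w) zero = nothing
letterAt (a ∷ w) (suc zero) = just a
letterAt (a ∷ w) (suc (suc p)) = letterAt w (suc p)

isLetter : {n : ℕ} → Maybe (Fin n) → Fin n → Bool
isLetter nothing a = false
isLetter (just b) a = does (b F.≟ a)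

positions : {A : Set} → List A → List ℕ
positions w = map suc (upTo (length w))

_[_↦_] : (Var → ℕ) → Var → ℕ → (Var → ℕ)
(i [ y ↦ j ]) v = if v ≡ᵇ y then j else i v

module _ {S : Signature} {n : ℕ} where

  ⟦_⟧ : Formula S n → List (Fin n) → (Var → ℕ) → Bool
  ⟦ Pₐ a y ⟧ w i = isLetter (letterAt w (i y)) a
  ⟦ Rel r ys ⟧ w i = relN S r (V.map i ys)
  ⟦ ftrue ⟧ w i = true
  ⟦ ffalse ⟧ w i = false
  ⟦ fnot φ ⟧ w i = not (⟦ φ ⟧ w i)
  ⟦ fand φ ψ ⟧ w i = ⟦ φ ⟧ w i ∧ ⟦ ψ ⟧ w i
  ⟦ for φ ψ ⟧ w i = ⟦ φ ⟧ w i ∨ ⟦ ψ ⟧ w i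
  ⟦ Qu q y φ ⟧ w i = quant S q (map (λ j → ⟦ φ ⟧ w (i [ y ↦ j ])) (positions w))

-- Marked words in context ctx: (w , i) with i(y) ∈ {1,…,|w|} for y ∈ ctx.
-- (Values of i outside ctx are irrelevant for formulas in context ctx.)
record Marked (n : ℕ) (ctx : Context) : Set where
  constructor mk
  field
    word   : List (Fin n)
    assign : Var → ℕ
    inRange : ∀ y → y ∈ ctx → (1 ≤ assign y) × (assign y ≤ length word)

open Marked public

_⊨_ : {S : Signature} {n : ℕ} {ctx : Context} → Marked n ctx → Formula S n → Set
m ⊨ φ = ⟦ φ ⟧ (word m) (assign m) ≡ true

Equiv : {S : Signature} {n : ℕ} → Context → Formula S n → Formula S n → Set
Equiv {S} {n} ctx φ ψ = (m : Marked n ctx) → ⟦ φ ⟧ (word m) (assign m) ≡ ⟦ ψ ⟧ (word m) (assign m)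

-- Words over an alphabet are the models of sentences (empty context);
-- the assignment is irrelevant for sentences.
_⊨ˢ_ : {S : Signature} {n : ℕ} → List (Fin n) → Formula S n → Set
u ⊨ˢ ψ = ⟦ ψ ⟧ u (λ _ → 0) ≡ true

bigOr : {S : Signature} {n : ℕ} → List (Formula S n) → Formula S n
bigOr = foldr for ffalse

letterMap : {S : Signature} {m m' : ℕ} → (Fin m → Fin m') → Formula S m' → Formula S m
letterMap {m = m} ζ (Pₐ b z) = bigOr (map (λ a → Pₐ a z) (filter (λ a → ζ a F.≟ b) (allFin m)))
letterMap ζ (Rel r ys) = Rel r ys
letterMap ζ ftrue = ftrue
letterMap ζ ffalse = ffalse
letterMap ζ (fnot φ) = fnot (letterMap ζ φ)
letterMap ζ (fand φ ψ) = fand (letterMap ζ φ) (letterMap ζ ψ)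
letterMap ζ (for φ ψ) = for (letterMap ζ φ) (letterMap ζ ψ)
letterMap ζ (Qu q y φ) = Qu q y (letterMap ζ φ)

-- A class of sentences Γ: for each finite alphabet Fin m a Boolean
-- subalgebra Γ(m) of 𝒬_{Fin m}[𝒩] (sentences modulo equivalence),
-- represented as a predicate on sentences closed under equivalence,
-- stable under all ζ_{𝒬[𝒩]}.

record ClassOfSentences (S : Signature) : Set₁ where
  field
    Γ        : (m : ℕ) → Formula S m → Set
    sentence : ∀ {m φ} → Γ m φ → InContext [] φ
    resp     : ∀ {m φ ψ} → Γ m φ → InContext [] ψ → Equiv [] φ ψ → Γ m ψ
    has-true : ∀ {m} → Γ m ftrue
    cl-not   : ∀ {m φ} → Γ m φ → Γ m (fnot φ)
    cl-and   : ∀ {m φ ψ} → Γ m φ → Γ m ψ → Γ m (fand φ ψ)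
    cl-map   : ∀ {m m'} (ζ : Fin m → Fin m') {φ} → Γ m' φ → Γ m (letterMap ζ φ)

-- A finite Boolean subalgebra Δ of 𝒬_{A,ctx}[𝒩] (formulas in context ctx
-- modulo equivalence), represented as a predicate closed under equivalence.

record FiniteSubalgebra (S : Signature) (n : ℕ) (ctx : Context) : Set₁ where
  field
    member   : Formula S n → Set
    inCtx    : ∀ {φ} → member φ → InContext ctx φ
    resp     : ∀ {φ ψ} → member φ → InContext ctx ψ → Equiv ctx φ ψ → member ψ
    has-true : member ftrue
    cl-not   : ∀ {φ} → member φ → member (fnot φ)
    cl-and   : ∀ {φ ψ} → member φ → member ψ → member (fand φ ψ)
    finite   : Σ (List (Formula S n)) λ l → ∀ {φ} → member φ → Any (Equiv ctx φ) l

IsAtom : {S : Signature} {n : ℕ} {ctx : Context} → FiniteSubalgebra S n ctx → Formula S n → Set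
IsAtom {ctx = ctx} Δ φ =
  FiniteSubalgebra.member Δ φ
  × ¬ Equiv ctx φ ffalse
  × (∀ ψ → FiniteSubalgebra.member Δ ψ → Equiv ctx (fand ψ φ) φ ⊎ Equiv ctx (fand ψ φ) ffalse)

-- An enumeration of the atoms of Δ (up to equivalence) by the alphabet
-- C_Δ = Fin k;  c ↦ φ_c.
record AtomEnum {S : Signature} {n : ℕ} {ctx : Context} (Δ : FiniteSubalgebra S n ctx) : Set where
  field
    k      : ℕ
    atom   : Fin k → Formula S n
    isAtom : ∀ c → IsAtom Δ (atom c)
    inj    : ∀ c d → Equiv ctx (atom c) (atom d) → c ≡ d
    surj   : ∀ φ → IsAtom Δ φ → ∃ λ c → Equiv ctx φ (atom c)

-- φ[x/z]: replace the free occurrences of x by z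
-- (used only when z does not occur in φ, so no capture can happen)
rename : {S : Signature} {n : ℕ} → Var → Var → Formula S n → Formula S n
rename x z (Pₐ a y) = Pₐ a (if y ≡ᵇ x then z else y)
rename x z (Rel r ys) = Rel r (V.map (λ y → if y ≡ᵇ x then z else y) ys)
rename x z ftrue = ftrue
rename x z ffalse = ffalse
rename x z (fnot φ) = fnot (rename x z φ)
rename x z (fand φ ψ) = fand (rename x z φ) (rename x z ψ)
rename x z (for φ ψ) = for (rename x z φ) (rename x z ψ)
rename x z (Qu q y φ) = if y ≡ᵇ x then Qu q y φ else Qu q y (rename x z φ)

-- σ_Δ on a representative ψ: replace each P_c(z) by φ_c[x/z]
subst : {S : Signature} {n k : ℕ} → (Fin k → Formula S n) → Var → Formula S k → Formula S n
subst φ x (Pₐ c z) = rename x z (φ c)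
subst φ x (Rel r ys) = Rel r ys
subst φ x ftrue = ftrue
subst φ x ffalse = ffalse
subst φ x (fnot ψ) = fnot (subst φ x ψ)
subst φ x (fand ψ χ) = fand (subst φ x ψ) (subst φ x χ)
subst φ x (for ψ χ) = for (subst φ x ψ) (subst φ x χ)
subst φ x (Qu q y ψ) = Qu q y (subst φ x ψ)

FreshFor : {S : Signature} {n k : ℕ} → Formula S k → Context → (Fin k → Formula S n) → Set
FreshFor ψ ctx φ = All (λ v → (v ∉ ctx) × (∀ c → v ∉ vars (φ c))) (vars ψ)

-- ξ_Δ and τ_Δ (relationally): u ∈ C_Δ^* is τ_Δ(w,i) iff |u| = |w| and the
-- j-th letter of u is the (unique) c with (w, i, j) ⊨ φ_c.

IsTau : {S : Signature} {n k : ℕ} {xs : Context} → (Fin k → Formula S n) → Var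
      → Marked n xs → List (Fin k) → Set
IsTau φ x m u =
  (length u ≡ length (word m))
  × (∀ j c → letterAt u j ≡ just c → ⟦ φ c ⟧ (word m) (assign m [ x ↦ j ]) ≡ true)

{-# OPTIONS --safe #-}
-- The only
-- case with content is a letter P_c(z) at position j: σ_Δ turns it into φ_c[x/z],
-- which (the variables of ψ being fresh for Δ) holds of (w, i) iff φ_c holds at
-- (w, i, j), and this is the case iff the j-th letter of τ_Δ(w, i) is c, because
-- at every marked word in context 𝐱 ∪ {x} exactly one atom of Δ holds. That some atom
-- holds is shown by intersecting, over a finite list covering Δ, the member or its
-- negation that holds at the point; this needs excluded middle on membership in Δ,
-- which is harmless because the conclusion is decidable.
module Submission where

open import Defs
open import Data.Nat using (ℕ; zero; suc; _≤_; _≡ᵇ_; _≟_; s≤s; z≤n)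
open import Data.Nat.Properties using (≡ᵇ⇒≡; ≡⇒≡ᵇ)
open import Data.Bool using (Bool; true; false; _∧_; _∨_; not; if_then_else_)
import Data.Bool as Bool
open import Data.Bool.Properties using (∧-comm; ∧-identityʳ; ∧-zeroʳ)
open import Data.Unit using (tt)
open import Data.Fin using (Fin)
import Data.Fin as Fin
open import Data.Fin.Properties using (any?)
open import Data.List using (List; []; _∷_; map; upTo; length)
open import Data.List.Properties using (map-cong; map-cong-local)
open import Data.List.Membership.Propositional using (_∈_; _∉_)
open import Data.List.Membership.Propositional.Properties
  using (∈-filter⁺; ∈-filter⁻; ∈-map⁻; ∈-upTo⁻; ∈-++⁺ˡ; ∈-++⁺ʳ)
open import Data.List.Relation.Unary.All as All using (All; []; _∷_)
open import Data.List.Relation.Unary.All.Properties using (++⁻ˡ; ++⁻ʳ)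
open import Data.List.Relation.Unary.Any using (here; there)
open import Data.Maybe using (just)
open import Data.Vec using (Vec)
import Data.Vec as Vec
import Data.Vec.Properties as Vec
open import Data.Product using (Σ; ∃; _×_; _,_; proj₁; proj₂)
open import Data.Sum using (_⊎_; inj₁; inj₂)
open import Data.Empty using (⊥-elim)
open import Function using (_∘_)
open import Relation.Nullary using (¬_; yes; no; ¬?; does; contradiction)
open import Relation.Nullary.Decidable using (decidable-stable; ¬¬-excluded-middle)
open import Relation.Binary.PropositionalEquality as ≡
  using (_≡_; _≢_; refl; sym; trans; cong; cong₂)
open ≡.≡-Reasoning

∧-absorbs : ∀ {a b} → (b ≡ true → a ≡ true) → a ∧ b ≡ b
∧-absorbs {b = true}  h = trans (∧-identityʳ _) (h refl)
∧-absorbs {b = false} _ = ∧-zeroʳ _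

∧-annihilates : ∀ {a b} → (b ≡ true → a ≡ false) → a ∧ b ≡ false
∧-annihilates {b = true}  h = trans (∧-identityʳ _) (h refl)
∧-annihilates {b = false} _ = ∧-zeroʳ _

∧-trueˡ : ∀ {a b} → a ∧ b ≡ true → a ≡ true
∧-trueˡ {true} _ = refl

∧-trueʳ : ∀ {a b} → a ∧ b ≡ true → b ≡ true
∧-trueʳ {true} h = h

not-true : ∀ {a} → not a ≡ true → a ≡ false
not-true {false} _ = refl

∈-tail : ∀ {v x : Var} {xs : Context} → v ∈ x ∷ xs → v ≢ x → v ∈ xs
∈-tail (here v≡x) v≢x = ⊥-elim (v≢x v≡x)
∈-tail (there v∈xs) _ = v∈xs

Vec-map-cong-local : ∀ {A B : Set} {k} {f g : A → B} (ys : Vec A k) →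
  (∀ {v} → v ∈ Vec.toList ys → f v ≡ g v) → Vec.map f ys ≡ Vec.map g ys
Vec-map-cong-local Vec.[] _ = refl
Vec-map-cong-local (y Vec.∷ ys) h =
  cong₂ Vec._∷_ (h (here refl)) (Vec-map-cong-local ys (h ∘ there))

update-elim : (P : ℕ → Set) (f : Var → ℕ) (y : Var) {j : ℕ} (v : Var) →
  P j → (v ≢ y → P (f v)) → P ((f [ y ↦ j ]) v)
update-elim P f y v pj pf with v ≡ᵇ y | ≡⇒≡ᵇ v y
... | true  | _   = pj
... | false | v≢y = pf v≢y

update-cong : (f g : Var → ℕ) (y : Var) {j j′ : ℕ} (v : Var) →
  j ≡ j′ → (v ≢ y → f v ≡ g v) → (f [ y ↦ j ]) v ≡ (g [ y ↦ j′ ]) v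
update-cong f g y v j≡j′ h with v ≡ᵇ y | ≡⇒≡ᵇ v y
... | true  | _   = j≡j′
... | false | v≢y = h v≢y

update-other : (f : Var → ℕ) {y v : Var} (j : ℕ) → v ≢ y → (f [ y ↦ j ]) v ≡ f v
update-other f {y} {v} j v≢y with v ≡ᵇ y | ≡ᵇ⇒≡ v y
... | false | _   = refl
... | true  | v≡y = ⊥-elim (v≢y (v≡y tt))

update-comm : (f : Var → ℕ) {x y : Var} (k j : ℕ) → x ≢ y →
  ∀ v → ((f [ y ↦ j ]) [ x ↦ k ]) v ≡ ((f [ x ↦ k ]) [ y ↦ j ]) v
update-comm f {x} {y} k j x≢y v with v ≡ᵇ x | ≡ᵇ⇒≡ v x | v ≡ᵇ y | ≡ᵇ⇒≡ v y
... | true  | v≡x | true  | v≡y = ⊥-elim (x≢y (trans (sym (v≡x tt)) (v≡y tt)))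
... | true  | _   | false | _   = refl
... | false | _   | true  | _   = refl
... | false | _   | false | _   = refl

IsPosition : {A : Set} → List A → ℕ → Set
IsPosition w j = (1 ≤ j) × (j ≤ length w)

∈-positions⁻ : {A : Set} (w : List A) {j : ℕ} → j ∈ positions w → IsPosition w j
∈-positions⁻ _ j∈ with ∈-map⁻ suc j∈
... | _ , i∈ , refl = s≤s z≤n , ∈-upTo⁻ i∈

positions-length : {A B : Set} (u : List A) (w : List B) →
  length u ≡ length w → positions u ≡ positions w
positions-length _ _ = cong (map suc ∘ upTo)

letterAt-position : {A : Set} (u : List A) {j : ℕ} → IsPosition u j → ∃ λ c → letterAt u j ≡ just c
letterAt-position (c ∷ u) {suc zero}    _           = c , refl
letterAt-position (_ ∷ u) {suc (suc j)} (_ , s≤s j≤) = letterAt-position u (s≤s z≤n , j≤)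

tabulate-positions : {A : Set} (P : ℕ → A → Set) (len : ℕ) →
  (∀ j → 1 ≤ j → j ≤ len → Σ A (P j)) →
  Σ (List A) λ u → (length u ≡ len) × (∀ j c → letterAt u j ≡ just c → P j c)
tabulate-positions P zero _ = [] , refl , λ { zero _ () ; (suc _) _ () }
tabulate-positions P (suc len) choose
  with choose 1 (s≤s z≤n) (s≤s z≤n)
     | tabulate-positions (P ∘ suc) len (λ j _ j≤len → choose (suc j) (s≤s z≤n) (s≤s j≤len))
... | c₁ , P₁c₁ | u , |u|≡len , Pu = c₁ ∷ u , cong suc |u|≡len , letters
  where
  letters : ∀ j c → letterAt (c₁ ∷ u) j ≡ just c → P j c
  letters (suc zero)    _ refl = P₁c₁
  letters (suc (suc j)) c e    = Pu (suc j) c e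

module _ {S : Signature} {n : ℕ} where

  ⟦⟧-coincidence : (φ : Formula S n) (w : List (Fin n)) {f g : Var → ℕ} →
    (∀ {v} → v ∈ fv φ → f v ≡ g v) → ⟦ φ ⟧ w f ≡ ⟦ φ ⟧ w g
  ⟦⟧-coincidence (Pₐ a y) w h = cong (λ t → isLetter (letterAt w t) a) (h (here refl))
  ⟦⟧-coincidence (Rel r ys) w h = cong (relN S r) (Vec-map-cong-local ys h)
  ⟦⟧-coincidence ftrue w h = refl
  ⟦⟧-coincidence ffalse w h = refl
  ⟦⟧-coincidence (fnot φ) w h = cong not (⟦⟧-coincidence φ w h)
  ⟦⟧-coincidence (fand φ ψ) w h =
    cong₂ _∧_ (⟦⟧-coincidence φ w (h ∘ ∈-++⁺ˡ)) (⟦⟧-coincidence ψ w (h ∘ ∈-++⁺ʳ (fv φ)))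
  ⟦⟧-coincidence (for φ ψ) w h =
    cong₂ _∨_ (⟦⟧-coincidence φ w (h ∘ ∈-++⁺ˡ)) (⟦⟧-coincidence ψ w (h ∘ ∈-++⁺ʳ (fv φ)))
  ⟦⟧-coincidence (Qu q y φ) w {f} {g} h = cong (quant S q) (map-cong (λ j →
    ⟦⟧-coincidence φ w λ {v} v∈ → update-cong f g y v refl (h ∘ ∈-filter⁺ (λ u → ¬? (u ≟ y)) v∈))
    (positions w))

  rename-var : (f : Var → ℕ) (x z y : Var) → f (if y ≡ᵇ x then z else y) ≡ (f [ x ↦ f z ]) y
  rename-var f x z y with y ≡ᵇ x
  ... | true  = refl
  ... | false = refl

  ⟦rename⟧ : (x z : Var) (φ : Formula S n) → z ∉ vars φ → (w : List (Fin n)) (f : Var → ℕ) →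
    ⟦ rename x z φ ⟧ w f ≡ ⟦ φ ⟧ w (f [ x ↦ f z ])
  ⟦rename⟧ x z (Pₐ a y) _ w f = cong (λ t → isLetter (letterAt w t) a) (rename-var f x z y)
  ⟦rename⟧ x z (Rel r ys) _ w f =
    cong (relN S r) (trans (sym (Vec.map-∘ f _ ys)) (Vec.map-cong (rename-var f x z) ys))
  ⟦rename⟧ x z ftrue _ w f = refl
  ⟦rename⟧ x z ffalse _ w f = refl
  ⟦rename⟧ x z (fnot φ) z∉ w f = cong not (⟦rename⟧ x z φ z∉ w f)
  ⟦rename⟧ x z (fand φ ψ) z∉ w f =
    cong₂ _∧_ (⟦rename⟧ x z φ (z∉ ∘ ∈-++⁺ˡ) w f) (⟦rename⟧ x z ψ (z∉ ∘ ∈-++⁺ʳ (vars φ)) w f)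
  ⟦rename⟧ x z (for φ ψ) z∉ w f =
    cong₂ _∨_ (⟦rename⟧ x z φ (z∉ ∘ ∈-++⁺ˡ) w f) (⟦rename⟧ x z ψ (z∉ ∘ ∈-++⁺ʳ (vars φ)) w f)
  ⟦rename⟧ x z (Qu q y φ) z∉ w f with y ≡ᵇ x | ≡ᵇ⇒≡ y x | ≡⇒≡ᵇ y x
  ... | true | y≡x | _ = ⟦⟧-coincidence (Qu q y φ) w λ v∈ →
    sym (update-other f (f z) λ v≡x →
      proj₂ (∈-filter⁻ (λ u → ¬? (u ≟ y)) {xs = fv φ} v∈) (trans v≡x (sym (y≡x tt))))
  ... | false | _ | y≢x = cong (quant S q) (map-cong (λ j → begin
      ⟦ rename x z φ ⟧ w (f [ y ↦ j ])
        ≡⟨ ⟦rename⟧ x z φ (z∉ ∘ there) w (f [ y ↦ j ]) ⟩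
      ⟦ φ ⟧ w ((f [ y ↦ j ]) [ x ↦ (f [ y ↦ j ]) z ])
        ≡⟨ cong (λ k → ⟦ φ ⟧ w ((f [ y ↦ j ]) [ x ↦ k ])) (update-other f j (z∉ ∘ here)) ⟩
      ⟦ φ ⟧ w ((f [ y ↦ j ]) [ x ↦ f z ])
        ≡⟨ ⟦⟧-coincidence φ w (λ {v} _ → update-comm f (f z) j (y≢x ∘ sym) v) ⟩
      ⟦ φ ⟧ w ((f [ x ↦ f z ]) [ y ↦ j ]) ∎) (positions w))

⟦_⟧ᵐ : {S : Signature} {n : ℕ} {ctx : Context} → Formula S n → Marked n ctx → Bool
⟦ φ ⟧ᵐ p = ⟦ φ ⟧ (word p) (assign p)

module Atoms {S : Signature} {n : ℕ} {ctx : Context} (Δ : FiniteSubalgebra S n ctx) where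
  open FiniteSubalgebra Δ

  -- A record rather than a function type, so that χ and φ are inferable from its type.
  record Entails (χ φ : Formula S n) : Set where
    constructor entails
    field entailed : (m : Marked n ctx) → ⟦ χ ⟧ᵐ m ≡ true → ⟦ φ ⟧ᵐ m ≡ true
  open Entails

  Settles : Formula S n → Formula S n → Set
  Settles χ φ = Entails χ φ ⊎ Entails χ (fnot φ)

  InΔ : Formula S n → Set
  InΔ e = Σ (Formula S n) λ φ → member φ × Equiv ctx φ e

  settles-resp : ∀ {χ φ ψ} → Equiv ctx φ ψ → Settles χ φ → Settles χ ψ
  settles-resp φ≈ψ (inj₁ h) = inj₁ (entails λ m t → trans (sym (φ≈ψ m)) (entailed h m t))
  settles-resp φ≈ψ (inj₂ h) = inj₂ (entails λ m t → trans (sym (cong not (φ≈ψ m))) (entailed h m t))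

  settles-weaken : ∀ {χ′ χ φ} → Entails χ′ χ → Settles χ φ → Settles χ′ φ
  settles-weaken χ′⊆χ (inj₁ h) = inj₁ (entails λ m → entailed h m ∘ entailed χ′⊆χ m)
  settles-weaken χ′⊆χ (inj₂ h) = inj₂ (entails λ m → entailed h m ∘ entailed χ′⊆χ m)

  settles-dichotomy : ∀ {χ ψ} → Settles χ ψ → Equiv ctx (fand ψ χ) χ ⊎ Equiv ctx (fand ψ χ) ffalse
  settles-dichotomy (inj₁ h) = inj₁ λ m → ∧-absorbs (entailed h m)
  settles-dichotomy (inj₂ h) = inj₂ λ m → ∧-annihilates (not-true ∘ entailed h m)

  literal-at : (p : Marked n ctx) {φ : Formula S n} → member φ →
    Σ (Formula S n) λ ℓ → member ℓ × ⟦ ℓ ⟧ᵐ p ≡ true × Settles ℓ φ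
  literal-at p {φ} φ∈Δ with ⟦ φ ⟧ᵐ p in φp
  ... | true  = φ , φ∈Δ , φp , inj₁ (entails λ _ t → t)
  ... | false = fnot φ , cl-not φ∈Δ , cong not φp , inj₂ (entails λ _ t → t)

  Cell : Marked n ctx → List (Formula S n) → Formula S n → Set
  Cell p l χ = member χ × ⟦ χ ⟧ᵐ p ≡ true × All (λ e → InΔ e → Settles χ e) l

  ¬¬-cell : (p : Marked n ctx) (l : List (Formula S n)) → ¬ ¬ ∃ (Cell p l)
  ¬¬-cell p [] ¬cell = ¬cell (ftrue , has-true , refl , [])
  ¬¬-cell p (e ∷ l) ¬cell = ¬¬-cell p l λ (χ , χ∈Δ , χp , settled) → ¬¬-excluded-middle λ where
    (no ¬e∈Δ) → ¬cell (χ , χ∈Δ , χp , (⊥-elim ∘ ¬e∈Δ) ∷ settled)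
    (yes (φ , φ∈Δ , φ≈e)) → let (ℓ , ℓ∈Δ , ℓp , ℓφ) = literal-at p φ∈Δ in
      ¬cell ( fand ℓ χ , cl-and ℓ∈Δ χ∈Δ , cong₂ _∧_ ℓp χp
            , (λ _ → settles-resp φ≈e (settles-weaken (entails λ _ → ∧-trueˡ) ℓφ))
            ∷ All.map (λ sₑ e∈Δ → settles-weaken (entails λ _ → ∧-trueʳ) (sₑ e∈Δ)) settled )

  cell-isAtom : (p : Marked n ctx) {χ : Formula S n} → Cell p (proj₁ finite) χ → IsAtom Δ χ
  cell-isAtom p {χ} (χ∈Δ , χp , settled) =
    χ∈Δ , (λ χ≈⊥ → contradiction (trans (sym χp) (χ≈⊥ p)) λ ()) , dichotomy
    where
    dichotomy : ∀ ψ → member ψ → Equiv ctx (fand ψ χ) χ ⊎ Equiv ctx (fand ψ χ) ffalse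
    dichotomy ψ ψ∈Δ with All.lookupAny settled (proj₂ finite ψ∈Δ)
    ... | settles-e , ψ≈e =
      settles-dichotomy {ψ = ψ} (settles-resp (sym ∘ ψ≈e) (settles-e (ψ , ψ∈Δ , ψ≈e)))

  atom-absorbs : ∀ {φ ψ} → IsAtom Δ φ → member ψ → (q : Marked n ctx) →
    ⟦ ψ ⟧ᵐ q ≡ true → ⟦ φ ⟧ᵐ q ≡ true → Equiv ctx (fand ψ φ) φ
  atom-absorbs (_ , _ , dichotomy) ψ∈Δ q ψq φq with dichotomy _ ψ∈Δ
  ... | inj₁ ψφ≈φ = ψφ≈φ
  ... | inj₂ ψφ≈⊥ with () ← trans (sym (cong₂ _∧_ ψq φq)) (ψφ≈⊥ q)

  meeting-atoms-equiv : ∀ {φ φ′} → IsAtom Δ φ → IsAtom Δ φ′ → (q : Marked n ctx) →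
    ⟦ φ ⟧ᵐ q ≡ true → ⟦ φ′ ⟧ᵐ q ≡ true → Equiv ctx φ φ′
  meeting-atoms-equiv {φ} {φ′} φ-atom φ′-atom q φq φ′q m = begin
    ⟦ φ ⟧ᵐ m                ≡⟨ sym (atom-absorbs φ-atom (proj₁ φ′-atom) q φ′q φq m) ⟩
    ⟦ φ′ ⟧ᵐ m ∧ ⟦ φ ⟧ᵐ m    ≡⟨ ∧-comm (⟦ φ′ ⟧ᵐ m) _ ⟩
    ⟦ φ ⟧ᵐ m ∧ ⟦ φ′ ⟧ᵐ m    ≡⟨ atom-absorbs φ′-atom (proj₁ φ-atom) q φq φ′q m ⟩
    ⟦ φ′ ⟧ᵐ m               ∎

  module _ (C : AtomEnum Δ) where
    open AtomEnum C

    atom-at : (p : Marked n ctx) → ∃ λ c → ⟦ atom c ⟧ᵐ p ≡ true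
    atom-at p = decidable-stable (any? λ c → ⟦ atom c ⟧ᵐ p Bool.≟ true) λ no-atom →
      ¬¬-cell p (proj₁ finite) λ (χ , cell) →
        let (c , χ≈c) = surj χ (cell-isAtom p cell) in
        no-atom (c , trans (sym (χ≈c p)) (proj₁ (proj₂ cell)))

    atom-unique : (q : Marked n ctx) {c c′ : Fin k} →
      ⟦ atom c ⟧ᵐ q ≡ true → ⟦ atom c′ ⟧ᵐ q ≡ true → c ≡ c′
    atom-unique q {c} {c′} cq c′q = inj c c′ (meeting-atoms-equiv (isAtom c) (isAtom c′) q cq c′q)

    atom-truth : (q : Marked n ctx) {c′ : Fin k} → ⟦ atom c′ ⟧ᵐ q ≡ true →
      ∀ c → ⟦ atom c ⟧ᵐ q ≡ does (c′ Fin.≟ c)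
    atom-truth q {c′} c′q c with c′ Fin.≟ c
    ... | yes refl = c′q
    ... | no c′≢c with ⟦ atom c ⟧ᵐ q in cq
    ...   | true  = ⊥-elim (c′≢c (atom-unique q c′q cq))
    ...   | false = refl

module Substitution {S : Signature} {n : ℕ} (xs : Context) (x : Var) (x∉xs : x ∉ xs)
  (Δ : FiniteSubalgebra S n (x ∷ xs)) (C : AtomEnum Δ) where
  open AtomEnum C
  open Atoms Δ using (atom-at; atom-truth)

  _at_ : (m : Marked n xs) {j : ℕ} → IsPosition (word m) j → Marked n (x ∷ xs)
  m at j-pos = mk (word m) (assign m [ x ↦ _ ]) λ y y∈ →
    update-elim (IsPosition (word m)) (assign m) x y j-pos (inRange m y ∘ ∈-tail y∈)

  tau-exists : (m : Marked n xs) → Σ (List (Fin k)) (IsTau atom x m)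
  tau-exists m = tabulate-positions (λ j c → ⟦ atom c ⟧ (word m) (assign m [ x ↦ j ]) ≡ true)
    (length (word m)) (λ j 1≤j j≤|w| → atom-at C (m at (1≤j , j≤|w|)))

  tau-letter : (m : Marked n xs) (u : List (Fin k)) → IsTau atom x m u →
    ∀ {j} → IsPosition (word m) j →
    ∀ c → ⟦ atom c ⟧ (word m) (assign m [ x ↦ j ]) ≡ isLetter (letterAt u j) c
  tau-letter m u (|u|≡|w| , letters) {j} (1≤j , j≤|w|) c
    with letterAt-position u (1≤j , ≡.subst (j ≤_) (sym |u|≡|w|) j≤|w|)
  ... | c′ , uj≡c′ = trans (atom-truth C (m at (1≤j , j≤|w|)) (letters j c′ uj≡c′) c)
                           (cong (λ l → isLetter l c) (sym uj≡c′))

  ⟦subst⟧ : (m : Marked n xs) (u : List (Fin k)) → IsTau atom x m u →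
    (ψ : Formula S k) → FreshFor ψ (x ∷ xs) atom → (i a : Var → ℕ) →
    (∀ {v} → v ∈ xs → i v ≡ assign m v) →
    (∀ {v} → v ∈ fv ψ → i v ≡ a v × IsPosition (word m) (a v)) →
    ⟦ subst atom x ψ ⟧ (word m) i ≡ ⟦ ψ ⟧ u a
  ⟦subst⟧ m u τ (Pₐ c z) ((_ , z∉Δ) ∷ []) i a i≈m i≈a with i≈a (here refl)
  ... | iz≡az , az-pos = begin
    ⟦ rename x z (atom c) ⟧ w i
      ≡⟨ ⟦rename⟧ x z (atom c) (z∉Δ c) w i ⟩
    ⟦ atom c ⟧ w (i [ x ↦ i z ])
      ≡⟨ ⟦⟧-coincidence (atom c) w (λ {v} v∈ →
           update-cong i (assign m) x v iz≡az (i≈m ∘ ∈-tail (inCtx-atom v∈))) ⟩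
    ⟦ atom c ⟧ w (assign m [ x ↦ a z ])
      ≡⟨ tau-letter m u τ az-pos c ⟩
    isLetter (letterAt u (a z)) c ∎
    where
    w = word m
    inCtx-atom : ∀ {v} → v ∈ fv (atom c) → v ∈ x ∷ xs
    inCtx-atom = All.lookup (FiniteSubalgebra.inCtx Δ (proj₁ (isAtom c)))
  ⟦subst⟧ m u τ (Rel r ys) _ i a i≈m i≈a = cong (relN S r) (Vec-map-cong-local ys (proj₁ ∘ i≈a))
  ⟦subst⟧ m u τ ftrue _ i a i≈m i≈a = refl
  ⟦subst⟧ m u τ ffalse _ i a i≈m i≈a = refl
  ⟦subst⟧ m u τ (fnot ψ) fresh i a i≈m i≈a = cong not (⟦subst⟧ m u τ ψ fresh i a i≈m i≈a)
  ⟦subst⟧ m u τ (fand ψ χ) fresh i a i≈m i≈a = cong₂ _∧_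
    (⟦subst⟧ m u τ ψ (++⁻ˡ (vars ψ) fresh) i a i≈m (i≈a ∘ ∈-++⁺ˡ))
    (⟦subst⟧ m u τ χ (++⁻ʳ (vars ψ) fresh) i a i≈m (i≈a ∘ ∈-++⁺ʳ (fv ψ)))
  ⟦subst⟧ m u τ (for ψ χ) fresh i a i≈m i≈a = cong₂ _∨_
    (⟦subst⟧ m u τ ψ (++⁻ˡ (vars ψ) fresh) i a i≈m (i≈a ∘ ∈-++⁺ˡ))
    (⟦subst⟧ m u τ χ (++⁻ʳ (vars ψ) fresh) i a i≈m (i≈a ∘ ∈-++⁺ʳ (fv ψ)))
  ⟦subst⟧ m u τ (Qu q y ψ) ((y∉ctx , _) ∷ fresh) i a i≈m i≈a = cong (quant S q) (begin
    map (λ j → ⟦ subst atom x ψ ⟧ w (i [ y ↦ j ])) (positions w)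
      ≡⟨ map-cong-local (All.tabulate λ {j} j∈ →
           ⟦subst⟧ m u τ ψ fresh (i [ y ↦ j ]) (a [ y ↦ j ]) i≈m′ (i≈a′ (∈-positions⁻ w j∈))) ⟩
    map (λ j → ⟦ ψ ⟧ u (a [ y ↦ j ])) (positions w)
      ≡⟨ cong (map λ j → ⟦ ψ ⟧ u (a [ y ↦ j ])) (positions-length w u (sym (proj₁ τ))) ⟩
    map (λ j → ⟦ ψ ⟧ u (a [ y ↦ j ])) (positions u) ∎)
    where
    w = word m
    ∈-fv-Qu : ∀ {v} → v ∈ fv ψ → v ≢ y → v ∈ fv (Qu q y ψ)
    ∈-fv-Qu = ∈-filter⁺ (λ v → ¬? (v ≟ y))
    i≈m′ : ∀ {j v} → v ∈ xs → (i [ y ↦ j ]) v ≡ assign m v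
    i≈m′ {j} v∈ = trans (update-other i j λ v≡y → y∉ctx (there (≡.subst (_∈ xs) v≡y v∈))) (i≈m v∈)
    i≈a′ : ∀ {j} → IsPosition w j → ∀ {v} → v ∈ fv ψ →
      (i [ y ↦ j ]) v ≡ (a [ y ↦ j ]) v × IsPosition w ((a [ y ↦ j ]) v)
    i≈a′ j-pos {v} v∈ = update-cong i a y v refl (proj₁ ∘ i≈a ∘ ∈-fv-Qu v∈)
                      , update-elim (IsPosition w) a y v j-pos (proj₂ ∘ i≈a ∘ ∈-fv-Qu v∈)

proposition5p2 : (S : Signature) (𝒞 : ClassOfSentences S) (n : ℕ)
    (xs : Context) (x : Var) → x ∉ xs →
    (Δ : FiniteSubalgebra S n (x ∷ xs)) (C : AtomEnum Δ) →
    let open AtomEnum C in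
    (ψ : Formula S k) → ClassOfSentences.Γ 𝒞 k ψ → FreshFor ψ (x ∷ xs) atom →
    ((m : Marked n xs) → Σ (List (Fin k)) (IsTau atom x m))
    × ((m : Marked n xs) (u : List (Fin k)) → IsTau atom x m u →
        ⟦ subst atom x ψ ⟧ (word m) (assign m) ≡ ⟦ ψ ⟧ u (λ _ → 0))
proposition5p2 S 𝒞 n xs x x∉xs Δ C ψ ψ∈Γ fresh =
  tau-exists , λ m u τ → ⟦subst⟧ m u τ ψ fresh (assign m) (λ _ → 0) (λ _ → refl) no-free-variable
  where
  open Substitution xs x x∉xs Δ C
  no-free-variable : ∀ {v} {P : Set} → v ∈ fv ψ → P
  no-free-variable v∈ with () ← All.lookup (ClassOfSentences.sentence 𝒞 ψ∈Γ) v∈
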